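{- Let $a<b$ be integers, let $K\subseteq F$ be sets of integers, and let $\varphi:[a,b]\to\{1,2,\dots\}$ satisfy, for every $x\in[a,b-1]$, $\varphi(x+1)-\varphi(x)=0$ if $x\in K$ and $\varphi(x+1)-\varphi(x)=1$ if $x\notin K$. Let $I=[a,b]$. Consider two random procedures that output an element of $I$. Procedure $D$: go through the elements $x$ of $[a,b)\setminus F$ in increasing order, and for each toss an independent coin that is $1$ with probability $1/\varphi(x)$; output the first $x$ whose coin is $1$, and output $b$ if all coins are $0$. Procedure $\hat D$: set $a'=a$ and repeat: let $y_0<y_1<\dots<y_{s-1}$ be the elements of $[a',b)\setminus K$; choose $h\in\{0,\dots,s\}$ by drawing a uniform real number $M\in[0,1]$ and letting $h$ be the index with $P'_h\le M<P'_{h+1}$, where $P'_0=0$, $P'_{i}=\sum_{q<i}P_q$, $P_q=\frac{1}{\varphi(a')+q}\prod_{\ell=0}^{q-1}\left(1-\frac{1}{\varphi(a')+\ell}\right)$ for $0\le q<s$ and $P'_{s+1}=1$ (so rank $s$ has probability $\prod_{\ell=0}^{s-1}(1-\frac{1}{\varphi(a')+\ell})$); if $h=s$ output $b$; else if $y_h\notin F$ output $y_h$; else set $a'=y_h+1$ and repeat. Then for every $x\in I\setminus F$, the probability $\hat D(x)$ that procedure $\hat D$ outputs $x$ equals the probability $D(x)$ that procedure $D$ outputs $x$.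
   Context: In the paper, $F$ is the set of already-exposed nodes (whose pointer $u$ is determined), $K=\{i:\mathrm{front}(i)\ne\mathrm{nil}$ and no $i'$ has $\mathrm{front}(i')=i\}\subseteq F$, $\varphi(x)=|\{i<x:\mathrm{front}(i)=\mathrm{nil}$ or $\mathrm{front}(i)<x\}|$ (which satisfies the increment property in the claim), and $I=[a,b]$ is the interval in which the next $u$-child of a node $j$ is sought, $b$ being the smallest already-known $u$-child of $j$ beyond the fully known area (or $n+1$). Procedure $D$ is the straightforward sequential sampling of the next child; procedure $\hat D$ is the efficient candidate-rejection sampling used by $\texttt{next-child}$. -}

module Defs where

open import Data.Bool using (Bool; true; false; if_then_else_; not)
open import Data.Nat as ℕ using (ℕ; zero; suc)
open import Data.Integer as ℤ using (ℤ; +_; ∣_∣)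
open import Data.Rational as ℚ using (ℚ; 0ℚ; 1ℚ)
open import Data.List using (List; []; _∷_)
open import Relation.Nullary using (does)

-- Sets of integers are given by their characteristic functions ℤ → Bool.

_==_ : ℤ → ℤ → Bool
x == y = does (x ℤ.≟ y)

range : ℤ → ℕ → List ℤ
range lo zero    = []
range lo (suc k) = lo ∷ range (lo ℤ.+ + 1) k

-- the half-open integer interval [lo, hi) in increasing order (used only when lo ≤ hi)
interval : ℤ → ℤ → List ℤ
interval lo hi = range lo ∣ hi ℤ.- lo ∣

without : (ℤ → Bool) → List ℤ → List ℤ
without S []       = []
without S (y ∷ ys) = if S y then without S ys else y ∷ without S ys

-- 1/m as a rational (m ≥ 1 in all uses; 0 is a dummy value for m = 0)
inv : ℕ → ℚ
inv zero    = 0ℚ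
inv (suc k) = (+ 1) ℚ./ suc k

indicator : Bool → ℚ
indicator true  = 1ℚ
indicator false = 0ℚ

-- Dlist φ F b ys x = probability that the output is x.

Dlist : (ℤ → ℕ) → (ℤ → Bool) → ℤ → List ℤ → ℤ → ℚ
Dlist φ F b []       x = indicator (x == b)
Dlist φ F b (y ∷ ys) x =
  if F y then Dlist φ F b ys x
  else (inv (φ y) ℚ.* indicator (y == x)
        ℚ.+ (1ℚ ℚ.- inv (φ y)) ℚ.* Dlist φ F b ys x)

Dprob : (ℤ → ℕ) → (ℤ → Bool) → ℤ → ℤ → ℤ → ℚ
Dprob φ F a b x = Dlist φ F b (interval a b) x

-- One round, started at a', with y_0 < ... < y_{s-1} the elements of [a',b) \ K:
-- rank h < s has probability P_h = 1/(φ(a')+h) · ∏_{ℓ<h} (1 - 1/(φ(a')+ℓ)),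
-- rank s has probability ∏_{ℓ<s} (1 - 1/(φ(a')+ℓ)).
-- `round rec b F m pr ys x` processes the ranks from the current one on, where
-- m = φ(a') + h and pr = ∏_{ℓ<h} (1 - 1/(φ(a')+ℓ)), and rec a'' is the
-- probability that a restart at a'' outputs x.

round : (ℤ → ℚ) → ℤ → (ℤ → Bool) → ℕ → ℚ → List ℤ → ℤ → ℚ
round rec b F m pr []       x = pr ℚ.* indicator (x == b)
round rec b F m pr (y ∷ ys) x =
  pr ℚ.* inv m ℚ.* (if F y then rec (y ℤ.+ + 1) else indicator (y == x))
  ℚ.+ round rec b F (suc m) (pr ℚ.* (1ℚ ℚ.- inv m)) ys x

-- probability that D̂ started at a' outputs x, computed with a recursion-depth
-- budget (fuel); every round strictly increases a' ≤ b, so fuel b - a' + 1 suffices.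
Dhat : (ℤ → ℕ) → (ℤ → Bool) → (ℤ → Bool) → ℤ → ℕ → ℤ → ℤ → ℚ
Dhat φ F K b zero    a' x = 0ℚ
Dhat φ F K b (suc n) a' x =
  round (λ a'' → Dhat φ F K b n a'' x) b F (φ a') 1ℚ (without K (interval a' b)) x

DhatProb : (ℤ → ℕ) → (ℤ → Bool) → (ℤ → Bool) → ℤ → ℤ → ℤ → ℚ
DhatProb φ F K a b x = Dhat φ F K b (suc ∣ b ℤ.- a ∣) a x

-- A round of D̂ that reaches the candidate y with weight pr stops there with
-- weight pr/m and passes it with weight pr(1 - 1/m); the counter m equals φ(y),
-- because φ rises by one exactly at the elements outside K.  If y ∈ F this
-- stop is a restart at y + 1, which by induction on b - a' is distributed as D
-- from y + 1, so stopping and passing recombine into D's skip of y; if y ∉ F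
-- they are D's coin at y.  Elements of K lie in F and are skipped by both.
module Submission where

open import Defs
open import Data.Bool using (Bool; true; false)
open import Data.Nat as ℕ using (ℕ; suc)
open import Data.Integer as ℤ using (ℤ; +_)
open import Data.Product using (_×_; _,_)
open import Data.List using (List)
open import Relation.Binary.PropositionalEquality using (_≡_)

import Data.Integer.Properties as ℤP
import Data.Nat.Properties as ℕP
open import Data.Integer.Tactic.RingSolver using (solve-∀)
open import Data.Rational as ℚ using (ℚ; 1ℚ)
import Data.Rational.Properties as ℚP
open import Data.Rational.Solver using (module +-*-Solver)
open import Relation.Binary.PropositionalEquality
  using (refl; sym; trans; cong; cong₂; subst; module ≡-Reasoning)

i<i+suc : ∀ i k → i ℤ.< i ℤ.+ + suc k
i<i+suc i k = subst (ℤ._< i ℤ.+ + suc k) (ℤP.+-identityʳ i) (ℤP.+-monoʳ-< i (ℤ.+<+ (ℕ.s≤s ℕ.z≤n)))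

i+j-i≡j : ∀ i j → (i ℤ.+ j) ℤ.- i ≡ j
i+j-i≡j = solve-∀

i+[j-i]≡j : ∀ i j → i ℤ.+ (j ℤ.- i) ≡ j
i+[j-i]≡j = solve-∀

i+∣j-i∣≡j : ∀ {i j} → i ℤ.≤ j → i ℤ.+ + ℤ.∣ j ℤ.- i ∣ ≡ j
i+∣j-i∣≡j {i} {j} i≤j = begin
  i ℤ.+ + ℤ.∣ j ℤ.- i ∣  ≡⟨ cong (λ z → i ℤ.+ z) (ℤP.0≤i⇒+∣i∣≡i (ℤP.i≤j⇒0≤j-i i≤j)) ⟩
  i ℤ.+ (j ℤ.- i)        ≡⟨ i+[j-i]≡j i j ⟩
  j                      ∎
  where open ≡-Reasoning

StepsOn : (ℤ → Bool) → (ℤ → ℕ) → ℤ → ℤ → Set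
StepsOn K φ lo hi = ∀ y → lo ℤ.≤ y → y ℤ.< hi →
  (K y ≡ true → φ (y ℤ.+ + 1) ≡ φ y) × (K y ≡ false → φ (y ℤ.+ + 1) ≡ suc (φ y))

stepsOn-suc : ∀ {K φ lo hi} → StepsOn K φ lo hi → StepsOn K φ (lo ℤ.+ + 1) hi
stepsOn-suc {lo = lo} steps y lo+1≤y = steps y (ℤP.≤-trans (ℤP.i≤i+j lo (+ 1)) lo+1≤y)

pass+stop≡pass : ∀ pr i r → pr ℚ.* i ℚ.* r ℚ.+ pr ℚ.* (1ℚ ℚ.- i) ℚ.* r ≡ pr ℚ.* r
pass+stop≡pass = solve 3 (λ pr i r → pr :* i :* r :+ pr :* (con 1ℚ :- i) :* r := pr :* r) refl
  where open +-*-Solver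

module _ (φ : ℤ → ℕ) (K F : ℤ → Bool) (K⊆F : ∀ y → K y ≡ true → F y ≡ true) (b x : ℤ) where

  Dfrom : ℤ → ℕ → ℚ
  Dfrom c k = Dlist φ F b (range c k) x

  RestartsCorrect : (ℤ → ℚ) → ℕ → Set
  RestartsCorrect rec N = ∀ c k → StepsOn K φ c b → c ℤ.+ + k ≡ b → k ℕ.< N → rec c ≡ Dfrom c k

  round-step : ∀ rec c k pr →
    (K c ≡ true → φ (c ℤ.+ + 1) ≡ φ c) × (K c ≡ false → φ (c ℤ.+ + 1) ≡ suc (φ c)) →
    rec (c ℤ.+ + 1) ≡ Dfrom (c ℤ.+ + 1) k →
    (∀ {m'} pr' → φ (c ℤ.+ + 1) ≡ m' →
       round rec b F m' pr' (without K (range (c ℤ.+ + 1) k)) x ≡ pr' ℚ.* Dfrom (c ℤ.+ + 1) k) →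
    round rec b F (φ c) pr (without K (range c (suc k))) x ≡ pr ℚ.* Dfrom c (suc k)
  -- `round` tests F c only after unfolding, out of reach of the with-abstraction;
  -- hence the `rewrite Fc` below.
  round-step rec c k pr (φ-same , φ-next) restart tail with K c in Kc | F c in Fc
  ... | true  | false with () ← trans (sym (K⊆F c Kc)) Fc
  ... | true  | true  = tail pr (φ-same refl)
  ... | false | true  rewrite Fc = begin
    pr ℚ.* inv (φ c) ℚ.* rec (c ℤ.+ + 1) ℚ.+ round rec b F (suc (φ c)) (pr ℚ.* (1ℚ ℚ.- inv (φ c))) rest x
      ≡⟨ cong₂ ℚ._+_ (cong (pr ℚ.* inv (φ c) ℚ.*_) restart) (tail _ (φ-next refl)) ⟩
    pr ℚ.* inv (φ c) ℚ.* D ℚ.+ pr ℚ.* (1ℚ ℚ.- inv (φ c)) ℚ.* D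
      ≡⟨ pass+stop≡pass pr (inv (φ c)) D ⟩
    pr ℚ.* D ∎
    where
    open ≡-Reasoning
    rest : List ℤ
    rest = without K (range (c ℤ.+ + 1) k)
    D : ℚ
    D = Dfrom (c ℤ.+ + 1) k
  ... | false | false rewrite Fc = begin
    pr ℚ.* inv (φ c) ℚ.* indicator (c == x) ℚ.+ round rec b F (suc (φ c)) (pr ℚ.* (1ℚ ℚ.- inv (φ c))) rest x
      ≡⟨ cong (pr ℚ.* inv (φ c) ℚ.* indicator (c == x) ℚ.+_) (tail _ (φ-next refl)) ⟩
    pr ℚ.* inv (φ c) ℚ.* indicator (c == x) ℚ.+ pr ℚ.* (1ℚ ℚ.- inv (φ c)) ℚ.* D
      ≡⟨ solve 5 (λ pr i d u r → pr :* i :* d :+ pr :* u :* r := pr :* (i :* d :+ u :* r)) refl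
               pr (inv (φ c)) (indicator (c == x)) (1ℚ ℚ.- inv (φ c)) D ⟩
    pr ℚ.* (inv (φ c) ℚ.* indicator (c == x) ℚ.+ (1ℚ ℚ.- inv (φ c)) ℚ.* D) ∎
    where
    open ≡-Reasoning
    open +-*-Solver
    rest : List ℤ
    rest = without K (range (c ℤ.+ + 1) k)
    D : ℚ
    D = Dfrom (c ℤ.+ + 1) k

  round≡D : ∀ rec N → RestartsCorrect rec N →
    ∀ k c m pr → StepsOn K φ c b → c ℤ.+ + k ≡ b → φ c ≡ m → k ℕ.≤ N →
    round rec b F m pr (without K (range c k)) x ≡ pr ℚ.* Dfrom c k
  round≡D rec N restarts ℕ.zero c m pr _ _ _ _ = refl
  round≡D rec N restarts (suc k) c _ pr steps c+k≡b refl k<N =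
    round-step rec c k pr (steps c ℤP.≤-refl c<b)
      (restarts (c ℤ.+ + 1) k steps′ c+1+k≡b k<N)
      (λ pr′ φ≡m′ → round≡D rec N restarts k (c ℤ.+ + 1) _ pr′ steps′ c+1+k≡b φ≡m′ (ℕP.<⇒≤ k<N))
    where
    c<b : c ℤ.< b
    c<b = subst (c ℤ.<_) c+k≡b (i<i+suc c k)
    steps′ : StepsOn K φ (c ℤ.+ + 1) b
    steps′ = stepsOn-suc steps
    c+1+k≡b : (c ℤ.+ + 1) ℤ.+ + k ≡ b
    c+1+k≡b = trans (ℤP.+-assoc c (+ 1) (+ k)) c+k≡b

  Dhat≡D : ∀ n c k → StepsOn K φ c b → c ℤ.+ + k ≡ b → k ℕ.≤ n →
    Dhat φ F K b (suc n) c x ≡ Dfrom c k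
  Dhat≡D n c k steps c+k≡b k≤n = begin
    round (restart n) b F (φ c) 1ℚ (without K (interval c b)) x
      ≡⟨ cong (λ j → round (restart n) b F (φ c) 1ℚ (without K (range c j)) x) ∣b-c∣≡k ⟩
    round (restart n) b F (φ c) 1ℚ (without K (range c k)) x
      ≡⟨ round≡D (restart n) n (restarts n) k c (φ c) 1ℚ steps c+k≡b refl k≤n ⟩
    1ℚ ℚ.* Dfrom c k
      ≡⟨ ℚP.*-identityˡ _ ⟩
    Dfrom c k ∎
    where
    open ≡-Reasoning
    restart : ℕ → ℤ → ℚ
    restart n a' = Dhat φ F K b n a' x
    ∣b-c∣≡k : ℤ.∣ b ℤ.- c ∣ ≡ k
    ∣b-c∣≡k = trans (cong (λ z → ℤ.∣ z ℤ.- c ∣) (sym c+k≡b)) (cong ℤ.∣_∣ (i+j-i≡j c (+ k)))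
    restarts : ∀ n → RestartsCorrect (restart n) n
    restarts (suc n) c′ k′ steps′ e′ (ℕ.s≤s k′≤n) = Dhat≡D n c′ k′ steps′ e′ k′≤n

-- Neither φ ≥ 1 nor x ∉ F is needed: the identity holds for every x, and
-- the junk value inv 0 = 0 enters both procedures in the same way.
lemma6 : (a b : ℤ) → a ℤ.< b →
         (K F : ℤ → Bool) → (∀ x → K x ≡ true → F x ≡ true) →
         (φ : ℤ → ℕ) →
         (∀ x → a ℤ.≤ x → x ℤ.≤ b → 1 ℕ.≤ φ x) →
         (∀ x → a ℤ.≤ x → x ℤ.< b →
            (K x ≡ true → φ (x ℤ.+ + 1) ≡ φ x) × (K x ≡ false → φ (x ℤ.+ + 1) ≡ suc (φ x))) →
         ∀ x → a ℤ.≤ x → x ℤ.≤ b → F x ≡ false →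
         DhatProb φ F K a b x ≡ Dprob φ F a b x
lemma6 a b a<b K F K⊆F φ _ steps x _ _ _ =
  Dhat≡D φ K F K⊆F b x ℤ.∣ b ℤ.- a ∣ a ℤ.∣ b ℤ.- a ∣ steps (i+∣j-i∣≡j (ℤP.<⇒≤ a<b)) ℕP.≤-refl
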